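{- Let $m\ge 3$ and let $LP_{1,m}=K_1(u_1)+\langle v_1,\dots,v_m\rangle$ be a long brush graph of diameter $2$ with $\langle v_1,\dots,v_m\rangle=K_{m_1}\cup K_{m_2}\cup\dots\cup K_{m_x}$ (disjoint union of complete graphs), where $x\ge2$, $1\le m_1\le m_2\le\dots\le m_x$, $m_1+m_2+\dots+m_x=m$, $m_1+m_2\ge 3$ and $m_1,\dots,m_x,x\in\mathbb{N}$. Then $LP_{1,m}$ is $2$-distance magic if and only if there exists $j$ with $1\le j\le m+1$ such that $J_{m+1}\setminus\{j\}$ can be partitioned into $x$ sets $S_1,\dots,S_x$ with $|S_i|=m_i$ for each $i$ and $\sum_{s\in S_1}s=\sum_{s\in S_2}s=\dots=\sum_{s\in S_x}s$ (with $u_1$ labeled $j$).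
   Context: $J_n=\{1,2,\dots,n\}$. All graphs are finite, simple and undirected; $d(u,v)$ is graph distance. For $u\in V(G)$ and $k\in\mathbb{N}$, $\partial N_k(u)=\{v\in V(G): d(u,v)=k\}$. For a graph $G$ of order $p\ge3$, a $k$-distance magic labeling is a bijection $f:V(G)\to J_p$ together with a constant $M$ such that $\sum_{w\in\partial N_k(u)} f(w)=M$ for every vertex $u$ with $\partial N_k(u)\neq\emptyset$, and $G$ has at least one pair of vertices at distance $k$; $G$ is $k$-distance magic if it has such a labeling. The long brush $LP_{1,m}$ has vertex set $\{u_1,v_1,\dots,v_m\}$, $u_1$ adjacent to every $v_i$, plus some edges among $v_1,\dots,v_m$; $K_1(u_1)+H$ denotes the join of the single vertex $u_1$ with the graph $H$, and $\langle v_1,\dots,v_m\rangle$ is the induced subgraph on $\{v_1,\dots,v_m\}$. -}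

module Defs where

open import Data.Nat using (ℕ; zero; suc; _+_; _≤_)
open import Data.Bool using (Bool; true; false; _∧_; _∨_; not; if_then_else_)
open import Data.Fin using (Fin; zero; suc; toℕ; _≟_)
open import Data.List using (List; map)
open import Data.Nat.ListAction using (sum)
open import Data.Bool.ListAction using (any)
open import Data.List using () renaming (allFin to allFinL)
open import Data.Vec using (lookup)
open import Data.Fin.Subset using (Subset)
open import Data.Product using (Σ; _×_; ∃; ∃-syntax)
open import Relation.Nullary.Decidable using (⌊_⌋)
open import Relation.Binary.PropositionalEquality using (_≡_)
open import Function.Definitions using (Bijective)

Adj : ℕ → Set
Adj p = Fin p → Fin p → Bool

ΣFin : (n : ℕ) → (Fin n → ℕ) → ℕ
ΣFin n g = sum (map g (allFinL n))

reach : {p : ℕ} → Adj p → ℕ → Fin p → Fin p → Bool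
reach G zero    u v = ⌊ u ≟ v ⌋
reach {p} G (suc n) u v = reach G n u v ∨ any (λ w → reach G n u w ∧ G w v) (allFinL _)

atDist : {p : ℕ} → Adj p → ℕ → Fin p → Fin p → Bool
atDist G zero    u v = ⌊ u ≟ v ⌋
atDist G (suc k) u v = reach G (suc k) u v ∧ not (reach G k u v)

-- Label of a vertex under f : Fin p → Fin p (a bijection onto J_p = {1..p}).
label : {p : ℕ} → (Fin p → Fin p) → Fin p → ℕ
label f v = suc (toℕ (f v))

distSum : {p : ℕ} → Adj p → ℕ → (Fin p → Fin p) → Fin p → ℕ
distSum {p} G k f u = ΣFin p (λ w → if atDist G k u w then label f w else 0)

IsKDMLabeling : {p : ℕ} → Adj p → ℕ → (Fin p → Fin p) → ℕ → Set
IsKDMLabeling {p} G k f M =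
  Bijective {A = Fin p} {B = Fin p} _≡_ _≡_ f ×
  (∀ u → (∃[ w ] atDist G k u w ≡ true) → distSum G k f u ≡ M)

KDistanceMagic : {p : ℕ} → Adj p → ℕ → Set
KDistanceMagic {p} G k =
  3 ≤ p ×
  (∃[ u ] ∃[ v ] atDist G k u v ≡ true) ×
  (∃[ f ] ∃[ M ] IsKDMLabeling G k f M)

-- Long brush LP_{1,m} = K_1(u_1) + (disjoint union of cliques).
-- Vertex zero is u_1; vertex suc a is v_{a+1}; c a is the clique containing v_{a+1}.
longBrush : (m x : ℕ) → (Fin m → Fin x) → Adj (suc m)
longBrush m x c zero    zero    = false
longBrush m x c zero    (suc b) = true
longBrush m x c (suc a) zero    = true
longBrush m x c (suc a) (suc b) = not ⌊ a ≟ b ⌋ ∧ ⌊ c a ≟ c b ⌋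

cliqueSize : {m x : ℕ} → (Fin m → Fin x) → Fin x → ℕ
cliqueSize {m} c i = ΣFin m (λ a → if ⌊ c a ≟ i ⌋ then 1 else 0)

-- Sum of the elements of S ⊆ J_n (element s : Fin n stands for the number toℕ s + 1).
subsetSum : {n : ℕ} → Subset n → ℕ
subsetSum {n} S = ΣFin n (λ s → if lookup S s then suc (toℕ s) else 0)

subsetCard : {n : ℕ} → Subset n → ℕ
subsetCard {n} S = ΣFin n (λ s → if lookup S s then 1 else 0)

{-# OPTIONS --safe #-}
module Submission where

-- The apex u₁ is adjacent to every vertex, so it has no vertex at distance 2, while the
-- vertices at distance 2 from v in the clique K_i are those of the other cliques.  Hence the
-- distance-2 sum at v is T − C_i, where T is the total label of v₁,…,v_m and C_i the label sum
-- of K_i, and a labelling is 2-distance magic exactly when all the C_i agree.  The label j of u₁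
-- and the label sets S_i of the cliques then form the required partition.  Conversely, a
-- partition is realised by any bijection sending u₁ to j and each K_i onto S_i, which exists
-- because |K_i| = |S_i|: it is a colour-preserving matching of two equinumerous colourings.

open import Defs
open import Data.Nat using (ℕ; zero; suc; _+_; _≤_; z≤n; s≤s)
open import Data.Nat.Properties using (≤-trans; n≤1+n; module ≤-Reasoning; m≤m+n; +-0-commutativeMonoid; +-identityʳ; +-cancelˡ-≡; +-cancelʳ-≡)
open import Data.Fin using (Fin; zero; suc; toℕ; punchIn; _≟_)
open import Data.Fin.Properties using (punchInᵢ≢i)
open import Data.Fin.Permutation as Perm using (Permutation; _⟨$⟩ʳ_; _⟨$⟩ˡ_; insert-punchIn)
open import Data.Fin.Subset using (Subset)
open import Data.Bool using (Bool; true; false; _∧_; _∨_; not; if_then_else_)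
open import Data.Bool.Properties using (∧-zeroʳ; ∨-identityʳ; T-≡)
open import Data.Bool.ListAction using (or)
import Data.List as List using (tabulate)
open import Data.List.Properties using (map-tabulate; tabulate-cong)
import Data.Nat.ListAction as List using (sum)
open import Data.Vec using (lookup; tabulate)
open import Data.Vec.Properties using (lookup∘tabulate)
open import Data.Product using (Σ; Σ-syntax; _×_; ∃-syntax; _,_; proj₁; proj₂)
open import Data.Empty using (⊥-elim)
open import Function.Definitions using (Bijective)
open import Function using (_∘_; _⇔_; mk⇔; mk⤖; Equivalence; Bijection)
open import Function.Properties.Bijection using (⤖⇒↔)
open import Function.Properties.Inverse using (↔⇒⤖)
open import Relation.Nullary using (yes; no)
open import Relation.Nullary.Decidable using (⌊_⌋; toWitness)
open import Relation.Binary.PropositionalEquality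
open import Algebra.Properties.CommutativeMonoid.Sum +-0-commutativeMonoid
  using (sum; sum-syntax; sum-remove; sum-cong-≗; sum-replicate-zero; ∑-distrib-+; ∑-permute)

private
  variable
    k m n x : ℕ

isYes-refl : (i : Fin n) → ⌊ i ≟ i ⌋ ≡ true
isYes-refl i = cong ⌊_⌋ (≡-≟-identity _≟_ refl)

isYes-≢ : {i j : Fin n} → i ≢ j → ⌊ i ≟ j ⌋ ≡ false
isYes-≢ i≢j = cong ⌊_⌋ (≢-≟-identity _≟_ i≢j)

isYes⇒≡ : {i j : Fin n} → ⌊ i ≟ j ⌋ ≡ true → i ≡ j
isYes⇒≡ e = toWitness (Equivalence.from T-≡ e)

isYes-suc : (i j : Fin n) → ⌊ suc i ≟ suc j ⌋ ≡ ⌊ i ≟ j ⌋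
isYes-suc i j with i ≟ j
... | yes _ = refl
... | no _  = refl

ΣFin≡∑ : (n : ℕ) (g : Fin n → ℕ) → ΣFin n g ≡ ∑[ i < n ] g i
ΣFin≡∑ n g = trans (cong List.sum (map-tabulate (λ i → i) g)) (listSum-tabulate n g)
  where
  listSum-tabulate : (n : ℕ) (g : Fin n → ℕ) → List.sum (List.tabulate g) ≡ sum g
  listSum-tabulate zero    g = refl
  listSum-tabulate (suc n) g = cong (g zero +_) (listSum-tabulate n (g ∘ suc))

fibreSize : (Fin n → Fin k) → Fin k → ℕ
fibreSize {n} col i = ∑[ a < n ] (if ⌊ col a ≟ i ⌋ then 1 else 0)

fibre-inhabited : (col : Fin n → Fin k) (i : Fin k) → 1 ≤ fibreSize col i → ∃[ a ] col a ≡ i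
fibre-inhabited {n = suc n} col i p with col zero ≟ i
... | yes e = zero , e
... | no _  = let a , e = fibre-inhabited (col ∘ suc) i p in suc a , e

fibre-image : (col : Fin n → Fin k) (a : Fin n) → 1 ≤ fibreSize col (col a)
fibre-image {n = suc n} col a = begin
  1                                       ≡⟨ cong (λ b → if b then 1 else 0) (isYes-refl (col a)) ⟨
  (if ⌊ col a ≟ col a ⌋ then 1 else 0)    ≤⟨ m≤m+n _ _ ⟩
  (if ⌊ col a ≟ col a ⌋ then 1 else 0) + fibreSize (col ∘ punchIn a) (col a)
                                          ≡⟨ sum-remove {i = a} (λ b → if ⌊ col b ≟ col a ⌋ then 1 else 0) ⟨
  fibreSize col (col a)                   ∎
  where open ≤-Reasoning

equalFibres⇒permutation : (c : Fin m → Fin k) (d : Fin n → Fin k) →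
  (∀ i → fibreSize c i ≡ fibreSize d i) → Σ[ π ∈ Permutation m n ] (∀ a → d (π ⟨$⟩ʳ a) ≡ c a)
equalFibres⇒permutation {m = zero} {n = zero} c d _ = Perm.id , λ ()
equalFibres⇒permutation {m = zero} {n = suc n} c d eq with subst (1 ≤_) (sym (eq (d zero))) (fibre-image d zero)
... | ()
equalFibres⇒permutation {m = suc m} {n = zero} c d eq with subst (1 ≤_) (eq (c zero)) (fibre-image c zero)
... | ()
equalFibres⇒permutation {m = suc m} {n = suc n} c d eq = Perm.insert zero t π , matches
  where
  ind : Fin _ → Fin _ → ℕ
  ind a i = if ⌊ a ≟ i ⌋ then 1 else 0
  sameColour : ∃[ t ] d t ≡ c zero
  sameColour = fibre-inhabited d (c zero) (subst (1 ≤_) (eq (c zero)) (fibre-image c zero))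
  t = proj₁ sameColour
  equalTailFibres : ∀ i → fibreSize (c ∘ suc) i ≡ fibreSize (d ∘ punchIn t) i
  equalTailFibres i = +-cancelˡ-≡ (ind (c zero) i) _ _ (begin
    ind (c zero) i + fibreSize (c ∘ suc) i       ≡⟨ eq i ⟩
    fibreSize d i                                ≡⟨ sum-remove {i = t} (λ a → ind (d a) i) ⟩
    ind (d t) i + fibreSize (d ∘ punchIn t) i    ≡⟨ cong (λ z → ind z i + fibreSize (d ∘ punchIn t) i) (proj₂ sameColour) ⟩
    ind (c zero) i + fibreSize (d ∘ punchIn t) i ∎)
    where open ≡-Reasoning
  onTails = equalFibres⇒permutation (c ∘ suc) (d ∘ punchIn t) equalTailFibres
  π = proj₁ onTails
  matches : ∀ a → d (Perm.insert zero t π ⟨$⟩ʳ a) ≡ c a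
  matches zero    = proj₂ sameColour
  matches (suc a) = trans (cong d (insert-punchIn zero t π a)) (proj₂ onTails a)

fibreSize-id : (j : Fin (suc n)) → fibreSize (λ s → s) j ≡ 1
fibreSize-id {n} j = begin
  fibreSize (λ s → s) j                                       ≡⟨ sum-remove {i = j} (λ s → if ⌊ s ≟ j ⌋ then 1 else 0) ⟩
  (if ⌊ j ≟ j ⌋ then 1 else 0) + fibreSize (punchIn j) j      ≡⟨ cong₂ _+_ (cong (λ b → if b then 1 else 0) (isYes-refl j)) rest≡0 ⟩
  1                                                           ∎
  where
  open ≡-Reasoning
  rest≡0 : fibreSize (punchIn j) j ≡ 0
  rest≡0 = trans (sum-cong-≗ (λ s → cong (λ b → if b then 1 else 0) (isYes-≢ (punchInᵢ≢i j s)))) (sum-replicate-zero n)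

∑-over-image : (π : Permutation n n) (S : Subset n) (P : Fin n → Bool) (ω : Fin n → ℕ) →
  (∀ w → lookup S (π ⟨$⟩ʳ w) ≡ P w) →
  ΣFin n (λ s → if lookup S s then ω s else 0) ≡ ∑[ w < n ] (if P w then ω (π ⟨$⟩ʳ w) else 0)
∑-over-image {n} π S P ω image = begin
  ΣFin n (λ s → if lookup S s then ω s else 0)                       ≡⟨ ΣFin≡∑ n _ ⟩
  ∑[ s < n ] (if lookup S s then ω s else 0)                         ≡⟨ ∑-permute _ π ⟩
  ∑[ w < n ] (if lookup S (π ⟨$⟩ʳ w) then ω (π ⟨$⟩ʳ w) else 0)     ≡⟨ sum-cong-≗ (λ w → cong (λ b → if b then ω (π ⟨$⟩ʳ w) else 0) (image w)) ⟩
  ∑[ w < n ] (if P w then ω (π ⟨$⟩ʳ w) else 0)                       ∎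
  where open ≡-Reasoning

or-tabulate-diagonal : (u : Fin n) (g : Fin n → Bool) → or (List.tabulate (λ w → ⌊ u ≟ w ⌋ ∧ g w)) ≡ g u
or-tabulate-diagonal {suc n} zero    g = trans (cong (g zero ∨_) (or-false n)) (∨-identityʳ (g zero))
  where
  or-false : (n : ℕ) → or (List.tabulate {n = n} (λ _ → false)) ≡ false
  or-false zero    = refl
  or-false (suc n) = or-false n
or-tabulate-diagonal {suc n} (suc u) g =
  trans (cong or (tabulate-cong (λ w → cong (_∧ g (suc w)) (isYes-suc u w)))) (or-tabulate-diagonal u (g ∘ suc))

reach₁ : (G : Adj n) (u v : Fin n) → reach G 1 u v ≡ ⌊ u ≟ v ⌋ ∨ G u v
reach₁ G u v = cong (⌊ u ≟ v ⌋ ∨_)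
  (trans (cong or (map-tabulate (λ w → w) (λ w → ⌊ u ≟ w ⌋ ∧ G w v))) (or-tabulate-diagonal u (λ w → G w v)))

IsEqualSumPartition : (ms : Fin x → ℕ) → Fin (suc m) → (Fin x → Subset (suc m)) → Set
IsEqualSumPartition ms j S =
  (∀ i → lookup (S i) j ≡ false) ×
  (∀ s → s ≢ j → ∃[ i ] lookup (S i) s ≡ true) ×
  (∀ i i' s → lookup (S i) s ≡ true → lookup (S i') s ≡ true → i ≡ i') ×
  (∀ i → subsetCard (S i) ≡ ms i) ×
  (∀ i i' → subsetSum (S i) ≡ subsetSum (S i'))

module LongBrush {m x : ℕ} (c : Fin m → Fin x) where

  G : Adj (suc m)
  G = longBrush m x c

  inDifferentCliques : Fin (suc m) → Fin (suc m) → Bool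
  inDifferentCliques (suc a) (suc b) = not ⌊ c a ≟ c b ⌋
  inDifferentCliques _       _       = false

  adjacent⇒not-atDist₂ : (u v : Fin (suc m)) → reach G 1 u v ≡ true → atDist G 2 u v ≡ false
  adjacent⇒not-atDist₂ u v e = trans (cong (λ r → reach G 2 u v ∧ not r) e) (∧-zeroʳ (reach G 2 u v))

  atDist₂≡inDifferentCliques : (u v : Fin (suc m)) → atDist G 2 u v ≡ inDifferentCliques u v
  atDist₂≡inDifferentCliques zero    zero    = adjacent⇒not-atDist₂ zero zero (reach₁ G zero zero)
  atDist₂≡inDifferentCliques zero    (suc b) = adjacent⇒not-atDist₂ zero (suc b) (reach₁ G zero (suc b))
  atDist₂≡inDifferentCliques (suc a) zero    = adjacent⇒not-atDist₂ (suc a) zero (reach₁ G (suc a) zero)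
  atDist₂≡inDifferentCliques (suc a) (suc b)
    rewrite reach₁ G (suc a) (suc b) | reach₁ G (suc a) zero | isYes-suc a b with a ≟ b
  ... | yes refl = cong not (sym (isYes-refl (c a)))
  ... | no _ with c a ≟ c b
  ...   | yes _ = refl
  ...   | no _  = refl

  atDist₂-differentCliques : {a b : Fin m} → c a ≢ c b → atDist G 2 (suc a) (suc b) ≡ true
  atDist₂-differentCliques {a} {b} ca≢cb = trans (atDist₂≡inDifferentCliques (suc a) (suc b)) (cong not (isYes-≢ ca≢cb))

  inClique : Fin x → Fin (suc m) → Bool
  inClique i zero    = false
  inClique i (suc b) = ⌊ c b ≟ i ⌋

  cliqueSize≡fibreSize : (i : Fin x) → cliqueSize c i ≡ fibreSize c i
  cliqueSize≡fibreSize i = ΣFin≡∑ m (λ a → if ⌊ c a ≟ i ⌋ then 1 else 0)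

  cliqueLabelSum : (Fin (suc m) → Fin (suc m)) → Fin x → ℕ
  cliqueLabelSum f i = ∑[ w < suc m ] (if inClique i w then label f w else 0)

  distSum₂+cliqueLabelSum : (f : Fin (suc m) → Fin (suc m)) (a : Fin m) →
    distSum G 2 f (suc a) + cliqueLabelSum f (c a) ≡ ∑[ b < m ] label f (suc b)
  distSum₂+cliqueLabelSum f a = begin
    distSum G 2 f (suc a) + cliqueLabelSum f (c a)
      ≡⟨ cong (_+ cliqueLabelSum f (c a)) (trans (ΣFin≡∑ (suc m) _) (sum-cong-≗ λ w →
           cong (λ d → if d then label f w else 0) (atDist₂≡inDifferentCliques (suc a) w))) ⟩
    ∑[ b < m ] (if not ⌊ c a ≟ c b ⌋ then label f (suc b) else 0) + ∑[ b < m ] (if ⌊ c b ≟ c a ⌋ then label f (suc b) else 0)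
      ≡⟨ ∑-distrib-+ (λ b → if not ⌊ c a ≟ c b ⌋ then label f (suc b) else 0)
                     (λ b → if ⌊ c b ≟ c a ⌋ then label f (suc b) else 0) ⟨
    ∑[ b < m ] ((if not ⌊ c a ≟ c b ⌋ then label f (suc b) else 0) + (if ⌊ c b ≟ c a ⌋ then label f (suc b) else 0))
      ≡⟨ sum-cong-≗ (λ b → complementary (c a) (c b) (label f (suc b))) ⟩
    ∑[ b < m ] label f (suc b) ∎
    where
    open ≡-Reasoning
    complementary : (i i' : Fin x) (n : ℕ) → (if not ⌊ i ≟ i' ⌋ then n else 0) + (if ⌊ i' ≟ i ⌋ then n else 0) ≡ n
    complementary i i' n with i ≟ i' | i' ≟ i
    ... | yes _   | yes _   = refl
    ... | yes i≡i' | no i'≢i = ⊥-elim (i'≢i (sym i≡i'))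
    ... | no i≢i' | yes i'≡i = ⊥-elim (i≢i' (sym i'≡i))
    ... | no _    | no _    = +-identityʳ n

  magic⇒equalCliqueLabelSums : (inhabited : ∀ i → ∃[ b ] c b ≡ i) → {i₀ i₁ : Fin x} → i₀ ≢ i₁ →
    {f : Fin (suc m) → Fin (suc m)} {M : ℕ} → IsKDMLabeling G 2 f M →
    ∀ i i' → cliqueLabelSum f i ≡ cliqueLabelSum f i'
  magic⇒equalCliqueLabelSums inhabited {i₀} {i₁} i₀≢i₁ {f} {M} (_ , magic) i i' =
    +-cancelˡ-≡ M _ _ (trans (complement i) (sym (complement i')))
    where
    otherClique : ∀ a → ∃[ b ] c a ≢ c b
    otherClique a with c a ≟ i₀
    ... | no ca≢i₀ = let b , cb≡i₀ = inhabited i₀ in b , λ ca≡cb → ca≢i₀ (trans ca≡cb cb≡i₀)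
    ... | yes ca≡i₀ = let b , cb≡i₁ = inhabited i₁ in b , λ ca≡cb → i₀≢i₁ (trans (sym ca≡i₀) (trans ca≡cb cb≡i₁))
    complement : ∀ i → M + cliqueLabelSum f i ≡ ∑[ b < m ] label f (suc b)
    complement i with inhabited i
    ... | a , refl = trans (cong (_+ cliqueLabelSum f (c a)) (sym (magic (suc a) (suc b , atDist₂-differentCliques ca≢cb))))
                           (distSum₂+cliqueLabelSum f a)
      where
      b = proj₁ (otherClique a)
      ca≢cb = proj₂ (otherClique a)

  equalCliqueLabelSums⇒magic : (a₀ : Fin m) {f : Fin (suc m) → Fin (suc m)} → Bijective _≡_ _≡_ f →
    (∀ i i' → cliqueLabelSum f i ≡ cliqueLabelSum f i') → IsKDMLabeling G 2 f (distSum G 2 f (suc a₀))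
  equalCliqueLabelSums⇒magic a₀ {f} bij equal = bij , magic
    where
    magic : ∀ u → (∃[ w ] atDist G 2 u w ≡ true) → distSum G 2 f u ≡ distSum G 2 f (suc a₀)
    magic zero    (w , at₂) with () ← trans (sym at₂) (atDist₂≡inDifferentCliques zero w)
    magic (suc a) _ = +-cancelʳ-≡ (cliqueLabelSum f (c a)) _ _ (begin
      distSum G 2 f (suc a) + cliqueLabelSum f (c a)    ≡⟨ distSum₂+cliqueLabelSum f a ⟩
      ∑[ b < m ] label f (suc b)                        ≡⟨ distSum₂+cliqueLabelSum f a₀ ⟨
      distSum G 2 f (suc a₀) + cliqueLabelSum f (c a₀)  ≡⟨ cong (distSum G 2 f (suc a₀) +_) (equal (c a₀) (c a)) ⟩
      distSum G 2 f (suc a₀) + cliqueLabelSum f (c a)   ∎)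
      where open ≡-Reasoning

  ImageOfCliques : Permutation (suc m) (suc m) → (Fin x → Subset (suc m)) → Set
  ImageOfCliques π S = ∀ i w → lookup (S i) (π ⟨$⟩ʳ w) ≡ inClique i w

  module _ (π : Permutation (suc m) (suc m)) (S : Fin x → Subset (suc m)) (image : ImageOfCliques π S) where

    image-card : ∀ i → subsetCard (S i) ≡ cliqueSize c i
    image-card i = trans (∑-over-image π (S i) (inClique i) (λ _ → 1) (image i)) (sym (cliqueSize≡fibreSize i))

    image-sum : ∀ i → subsetSum (S i) ≡ cliqueLabelSum (π ⟨$⟩ʳ_) i
    image-sum i = ∑-over-image π (S i) (inClique i) (λ s → suc (toℕ s)) (image i)

    image-lookup : ∀ i s → lookup (S i) s ≡ inClique i (π ⟨$⟩ˡ s)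
    image-lookup i s = trans (cong (lookup (S i)) (sym (Perm.inverseʳ π))) (image i (π ⟨$⟩ˡ s))

    image⇒partition : {ms : Fin x → ℕ} → (∀ i → cliqueSize c i ≡ ms i) →
      (∀ i i' → cliqueLabelSum (π ⟨$⟩ʳ_) i ≡ cliqueLabelSum (π ⟨$⟩ʳ_) i') →
      IsEqualSumPartition ms (π ⟨$⟩ʳ zero) S
    image⇒partition sizes equal = (λ i → image i zero) , covers , disjoint
      , (λ i → trans (image-card i) (sizes i))
      , (λ i i' → trans (image-sum i) (trans (equal i i') (sym (image-sum i'))))
      where
      covers : ∀ s → s ≢ π ⟨$⟩ʳ zero → ∃[ i ] lookup (S i) s ≡ true
      covers s s≢j with π ⟨$⟩ˡ s in eq
      ... | zero  = ⊥-elim (s≢j (trans (sym (Perm.inverseʳ π)) (cong (π ⟨$⟩ʳ_) eq)))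
      ... | suc b = c b , trans (image-lookup (c b) s) (trans (cong (inClique (c b)) eq) (isYes-refl (c b)))
      disjoint : ∀ i i' s → lookup (S i) s ≡ true → lookup (S i') s ≡ true → i ≡ i'
      disjoint i i' s s∈Sᵢ s∈Sᵢ' with π ⟨$⟩ˡ s | image-lookup i s | image-lookup i' s
      ... | zero  | eq | _   with () ← trans (sym s∈Sᵢ) eq
      ... | suc b | eq | eq' = trans (sym (isYes⇒≡ (trans (sym eq) s∈Sᵢ))) (isYes⇒≡ (trans (sym eq') s∈Sᵢ'))

  -- Colour 0 is taken by u₁ and by the label j, colour 1 + i by the clique K_i and by S_i.
  vertexColour : Fin (suc m) → Fin (suc x)
  vertexColour zero    = zero
  vertexColour (suc b) = suc (c b)

  vertexColour-suc : ∀ w i → ⌊ vertexColour w ≟ suc i ⌋ ≡ inClique i w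
  vertexColour-suc zero    i = refl
  vertexColour-suc (suc b) i = isYes-suc (c b) i

  module LabelColouring (j : Fin (suc m)) (S : Fin x → Subset (suc m))
           (avoids : ∀ i → lookup (S i) j ≡ false)
           (covers : ∀ s → s ≢ j → ∃[ i ] lookup (S i) s ≡ true)
           (disjoint : ∀ i i' s → lookup (S i) s ≡ true → lookup (S i') s ≡ true → i ≡ i') where

    labelColour : Fin (suc m) → Fin (suc x)
    labelColour s with s ≟ j
    ... | yes _   = zero
    ... | no s≢j = suc (proj₁ (covers s s≢j))

    labelColour-zero : ∀ s → ⌊ labelColour s ≟ zero ⌋ ≡ ⌊ s ≟ j ⌋
    labelColour-zero s with s ≟ j
    ... | yes _ = refl
    ... | no _  = refl

    labelColour-suc : ∀ s i → ⌊ labelColour s ≟ suc i ⌋ ≡ lookup (S i) s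
    labelColour-suc s i with s ≟ j
    ... | yes refl = sym (avoids i)
    ... | no s≢j  = trans (isYes-suc _ i) (membership (proj₂ (covers s s≢j)))
      where
      membership : {i' : Fin x} → lookup (S i') s ≡ true → ⌊ i' ≟ i ⌋ ≡ lookup (S i) s
      membership {i'} s∈Sᵢ' with i' ≟ i
      ... | yes refl = sym s∈Sᵢ'
      ... | no i'≢i with lookup (S i) s in s∈?Sᵢ
      ...   | true  = ⊥-elim (i'≢i (disjoint i' i s s∈Sᵢ' s∈?Sᵢ))
      ...   | false = refl

  partition⇒image : {ms : Fin x → ℕ} → (∀ i → cliqueSize c i ≡ ms i) →
    (j : Fin (suc m)) (S : Fin x → Subset (suc m)) → IsEqualSumPartition ms j S → Σ[ π ∈ Permutation (suc m) (suc m) ] ImageOfCliques π S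
  partition⇒image sizes j S (avoids , covers , disjoint , cards , _) = π , image
    where
    open LabelColouring j S avoids covers disjoint
    equalFibres : ∀ k → fibreSize vertexColour k ≡ fibreSize labelColour k
    equalFibres zero = begin
      1 + ∑[ b < m ] 0                 ≡⟨ cong suc (sum-replicate-zero m) ⟩
      1                                ≡⟨ fibreSize-id j ⟨
      fibreSize (λ s → s) j            ≡⟨ sum-cong-≗ (λ s → cong (λ b → if b then 1 else 0) (labelColour-zero s)) ⟨
      fibreSize labelColour zero       ∎
      where open ≡-Reasoning
    equalFibres (suc i) = begin
      fibreSize vertexColour (suc i)                   ≡⟨ sum-cong-≗ (λ w → cong (λ b → if b then 1 else 0) (vertexColour-suc w i)) ⟩
      ∑[ w < suc m ] (if inClique i w then 1 else 0)   ≡⟨ cliqueSize≡fibreSize i ⟨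
      cliqueSize c i                                   ≡⟨ trans (sizes i) (sym (cards i)) ⟩
      subsetCard (S i)                                 ≡⟨ ΣFin≡∑ (suc m) _ ⟩
      ∑[ s < suc m ] (if lookup (S i) s then 1 else 0) ≡⟨ sum-cong-≗ (λ s → cong (λ b → if b then 1 else 0) (labelColour-suc s i)) ⟨
      fibreSize labelColour (suc i)                    ∎
      where open ≡-Reasoning
    matching = equalFibres⇒permutation vertexColour labelColour equalFibres
    π = proj₁ matching
    image : ImageOfCliques π S
    image i w = begin
      lookup (S i) (π ⟨$⟩ʳ w)            ≡⟨ labelColour-suc (π ⟨$⟩ʳ w) i ⟨
      ⌊ labelColour (π ⟨$⟩ʳ w) ≟ suc i ⌋ ≡⟨ cong (λ k → ⌊ k ≟ suc i ⌋) (proj₂ matching w) ⟩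
      ⌊ vertexColour w ≟ suc i ⌋         ≡⟨ vertexColour-suc w i ⟩
      inClique i w                       ∎
      where open ≡-Reasoning

  module _ {ms : Fin x → ℕ} (sizes : ∀ i → cliqueSize c i ≡ ms i) (inhabited : ∀ i → ∃[ b ] c b ≡ i)
           {i₀ i₁ : Fin x} (i₀≢i₁ : i₀ ≢ i₁) where

    magic⇒partition : KDistanceMagic G 2 → Σ[ j ∈ Fin (suc m) ] Σ[ S ∈ (Fin x → Subset (suc m)) ] IsEqualSumPartition ms j S
    magic⇒partition (_ , _ , _ , _ , labelling) = π ⟨$⟩ʳ zero , S , image⇒partition π S image sizes
      (magic⇒equalCliqueLabelSums inhabited i₀≢i₁ labelling)
      where
      π : Permutation (suc m) (suc m)
      π = ⤖⇒↔ (mk⤖ (proj₁ labelling))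
      S : Fin x → Subset (suc m)
      S i = tabulate (λ s → inClique i (π ⟨$⟩ˡ s))
      image : ImageOfCliques π S
      image i w = trans (lookup∘tabulate (λ s → inClique i (π ⟨$⟩ˡ s)) (π ⟨$⟩ʳ w)) (cong (inClique i) (Perm.inverseˡ π))

    partition⇒magic : 3 ≤ m → Σ[ j ∈ Fin (suc m) ] Σ[ S ∈ (Fin x → Subset (suc m)) ] IsEqualSumPartition ms j S →
      KDistanceMagic G 2
    partition⇒magic 3≤m (j , S , partition@(_ , _ , _ , _ , equalSums)) =
      ≤-trans 3≤m (n≤1+n m) , (suc b₀ , suc b₁ , atDist₂-differentCliques cb₀≢cb₁) ,
      π ⟨$⟩ʳ_ , _ , equalCliqueLabelSums⇒magic b₀ (Bijection.bijective (↔⇒⤖ π)) equal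
      where
      b₀ = proj₁ (inhabited i₀)
      b₁ = proj₁ (inhabited i₁)
      cb₀≢cb₁ : c b₀ ≢ c b₁
      cb₀≢cb₁ e = i₀≢i₁ (trans (sym (proj₂ (inhabited i₀))) (trans e (proj₂ (inhabited i₁))))
      π : Permutation (suc m) (suc m)
      π = proj₁ (partition⇒image sizes j S partition)
      image : ImageOfCliques π S
      image = proj₂ (partition⇒image sizes j S partition)
      equal : ∀ i i' → cliqueLabelSum (π ⟨$⟩ʳ_) i ≡ cliqueLabelSum (π ⟨$⟩ʳ_) i'
      equal i i' = trans (sym (image-sum π S image i)) (trans (equalSums i i') (image-sum π S image i'))

theorem4p1 : (m x : ℕ) → 3 ≤ m → 2 ≤ x →
  (ms : Fin x → ℕ) →
  (∀ i → 1 ≤ ms i) →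
  (∀ i i' → toℕ i ≤ toℕ i' → ms i ≤ ms i') →
  ΣFin x ms ≡ m →
  (∀ (i₀ i₁ : Fin x) → toℕ i₀ ≡ 0 → toℕ i₁ ≡ 1 → 3 ≤ ms i₀ + ms i₁) →
  (c : Fin m → Fin x) →
  (∀ i → cliqueSize c i ≡ ms i) →
  KDistanceMagic (longBrush m x c) 2 ⇔
    (Σ (Fin (suc m)) λ j → Σ (Fin x → Subset (suc m)) λ S →
      ((∀ i → lookup (S i) j ≡ false) ×
       (∀ s → s ≢ j → ∃[ i ] lookup (S i) s ≡ true) ×
       (∀ i i' s → lookup (S i) s ≡ true → lookup (S i') s ≡ true → i ≡ i') ×
       (∀ i → subsetCard (S i) ≡ ms i) ×
       (∀ i i' → subsetSum (S i) ≡ subsetSum (S i'))))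
theorem4p1 m x 3≤m (s≤s (s≤s z≤n)) ms ms≥1 _ _ _ c sizes =
  mk⇔ (magic⇒partition sizes inhabited zero≢one) (partition⇒magic sizes inhabited zero≢one 3≤m)
  where
  open LongBrush c
  inhabited : ∀ i → ∃[ b ] c b ≡ i
  inhabited i = fibre-inhabited c i (subst (1 ≤_) (trans (sym (sizes i)) (cliqueSize≡fibreSize i)) (ms≥1 i))
  zero≢one : zero ≢ suc zero
  zero≢one ()
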